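{- Let $\mathcal{C}\subseteq\mathbb{N}^d$ be a positive integer cone and let $S$ be a UESY-semigroup, i.e. $S=T\cup\{\operatorname{F}(T)\}$ for some symmetric $\mathcal{C}$-semigroup $T$. Then $S$ is primary positioned.
   Context: Let $d\geq 1$. For a finite set $A\subseteq\mathbb{N}^d$, the positive integer cone spanned by $A$ is $\mathcal{C}=\{\sum_{i=1}^n q_ia_i : n\in\mathbb{N}, a_i\in A, q_i\in\mathbb{Q}_{\geq0}\}\cap\mathbb{N}^d$. A $\mathcal{C}$-semigroup is a finitely generated submonoid $S$ of $(\mathbb{N}^d,+)$ with $S\subseteq\mathcal{C}$ and $\mathcal{C}\setminus S$ finite. Put $\mathcal{H}(S)=\mathcal{C}\setminus S$. For $x,y$ write $x\leq_{\mathcal{C}}y$ iff $y-x\in\mathcal{C}$. For $k\in\mathcal{C}$ let $\operatorname{I}_{\mathcal{C}}(k)=\{x\in\mathcal{C}: x\leq_{\mathcal{C}}k\}$. $S$ is $k$-positioned if $k-h\in S$ for every $h\in\mathcal{H}(S)$. Define $\operatorname{C}(S)=\{x\in\mathcal{C}: x\leq_{\mathcal{C}}h\text{ for some }h\in\mathcal{H}(S)\}$ and $\operatorname{M}(S)=\{h\in\mathcal{H}(S): \{s\in S: h-s\in S\}=\{0\}\}\cup\{0\}$. $S$ is primary positioned (for $k$) if there is $k\in\mathcal{C}$ such that $S$ is $k$-positioned and $|\operatorname{M}(S)|+|\operatorname{C}(S)|=|\operatorname{I}_{\mathcal{C}}(k)|$. A term order $\preceq$ on $\mathbb{N}^d$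 is a total order with $0\preceq v$ for all $v$ and $u\preceq v\Rightarrow u+w\preceq v+w$. The Frobenius element is $\operatorname{F}_\preceq(S)=\max_\preceq\mathcal{H}(S)$. The pseudo-Frobenius set is $\operatorname{PF}(S)=\{x\in\mathcal{H}(S): x+(S\setminus\{0\})\subseteq S\}$. $S$ is symmetric if $\operatorname{PF}(S)=\{\operatorname{F}_\preceq(S)\}$ for a term order $\preceq$; in that case the Frobenius element does not depend on the term order and is denoted $\operatorname{F}(S)$. -}

module Defs where

open import Data.Nat using (ℕ; zero; suc)
import Data.Nat as ℕ
open import Data.Integer using (+_)
open import Data.Rational as ℚ using (ℚ; 0ℚ; _/_)
open import Data.Vec as Vec using (Vec; replicate; zipWith; map)
open import Data.List using (List; []; _∷_; length)
open import Data.List.Membership.Propositional using (_∈_)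
open import Data.List.Relation.Unary.Unique.Propositional using (Unique)
open import Data.Product using (Σ; ∃; ∃-syntax; _×_; _,_; proj₁; proj₂)
open import Data.Sum using (_⊎_)
open import Relation.Nullary using (¬_)
open import Relation.Binary.PropositionalEquality using (_≡_; _≢_)
open import Relation.Binary.Structures using (IsTotalOrder)
open import Function.Bundles using (_⇔_)

Point : ℕ → Set
Point d = Vec ℕ d

Subset : ℕ → Set₁
Subset d = Point d → Set

𝟎 : ∀ {d} → Point d
𝟎 = replicate _ 0

infixl 6 _⊕_
_⊕_ : ∀ {d} → Point d → Point d → Point d
_⊕_ = zipWith ℕ._+_

toℚ : ∀ {d} → Point d → Vec ℚ d
toℚ = map (λ n → + n / 1)

combo : ∀ {d} → List (ℚ × Point d) → Vec ℚ d
combo [] = replicate _ 0ℚ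
combo ((q , a) ∷ qas) = zipWith ℚ._+_ (map (q ℚ.*_) (toℚ a)) (combo qas)

Cone : ∀ {d} → List (Point d) → Subset d
Cone A x = ∃[ qas ] ((∀ {q a} → (q , a) ∈ qas → (a ∈ A × 0ℚ ℚ.≤ q)) × toℚ x ≡ combo qas)

-- x ≤_𝒞 y iff y - x ∈ 𝒞 (⊆ ℕ^d), i.e. y = x + z for some z ∈ 𝒞
_≤[_]_ : ∀ {d} → Point d → List (Point d) → Point d → Set
x ≤[ A ] y = ∃[ z ] (Cone A z × y ≡ x ⊕ z)

I : ∀ {d} → List (Point d) → Point d → Subset d
I A k x = Cone A x × x ≤[ A ] k

Finite : ∀ {d} → Subset d → Set
Finite P = ∃[ L ] (∀ x → P x ⇔ x ∈ L)

HasSize : ∀ {d} → Subset d → ℕ → Set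
HasSize P n = ∃[ L ] (Unique L × (∀ x → P x ⇔ x ∈ L) × length L ≡ n)

data Generated {d} (G : List (Point d)) : Point d → Set where
  gen-zero : Generated G 𝟎
  gen-step : ∀ {g x} → g ∈ G → Generated G x → Generated G (g ⊕ x)

IsSubmonoid : ∀ {d} → Subset d → Set
IsSubmonoid S = S 𝟎 × (∀ {x y} → S x → S y → S (x ⊕ y))

FinitelyGenerated : ∀ {d} → Subset d → Set
FinitelyGenerated S = ∃[ G ] (∀ x → S x ⇔ Generated G x)

Hole : ∀ {d} → List (Point d) → Subset d → Subset d
Hole A S x = Cone A x × ¬ S x

record IsCSemigroup {d} (A : List (Point d)) (S : Subset d) : Set where
  field
    submonoid  : IsSubmonoid S
    finGen     : FinitelyGenerated S
    inCone     : ∀ {x} → S x → Cone A x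
    finHoles   : Finite (Hole A S)

record TermOrder (d : ℕ) : Set₁ where
  field
    _≼_          : Point d → Point d → Set
    isTotalOrder : IsTotalOrder _≡_ _≼_
    zero-least   : ∀ v → 𝟎 ≼ v
    compatible   : ∀ {u v} w → u ≼ v → (u ⊕ w) ≼ (v ⊕ w)

IsFrobenius : ∀ {d} → List (Point d) → TermOrder d → Subset d → Point d → Set
IsFrobenius A ≼ S f = Hole A S f × (∀ h → Hole A S h → h ≼' f)
  where open TermOrder ≼ renaming (_≼_ to _≼'_)

IsPF : ∀ {d} → List (Point d) → Subset d → Point d → Set
IsPF A S x = Hole A S x × (∀ s → S s → s ≢ 𝟎 → S (x ⊕ s))

-- S symmetric: PF(S) = {F_≼(S)} for some term order ≼.
-- The witness records the term order and the Frobenius element F(S).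
Symmetric : ∀ {d} → List (Point d) → Subset d → Set₁
Symmetric A S = Σ (TermOrder _) λ ≼ → ∃[ f ] (IsFrobenius A ≼ S f × (∀ x → IsPF A S x ⇔ x ≡ f))

F : ∀ {d} {A : List (Point d)} {S : Subset d} → Symmetric A S → Point d
F (_ , f , _) = f

KPositioned : ∀ {d} → List (Point d) → Subset d → Point d → Set
KPositioned A S k = ∀ h → Hole A S h → ∃[ s ] (S s × k ≡ h ⊕ s)

CS : ∀ {d} → List (Point d) → Subset d → Subset d
CS A S x = Cone A x × ∃[ h ] (Hole A S h × x ≤[ A ] h)

M : ∀ {d} → List (Point d) → Subset d → Subset d
M A S h = (Hole A S h × (∀ s → S s → s ≤[ A ] h → s ≡ 𝟎)) ⊎ h ≡ 𝟎

PrimaryPositioned : ∀ {d} → List (Point d) → Subset d → Set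
PrimaryPositioned A S =
  ∃[ k ] (Cone A k × KPositioned A S k ×
    ∃[ m ] ∃[ c ] ∃[ i ] (HasSize (M A S) m × HasSize (CS A S) c × HasSize (I A k) i × m ℕ.+ c ≡ i))

UESY : ∀ {d} {A : List (Point d)} {T : Subset d} → Symmetric A T → Subset d
UESY {T = T} sym x = T x ⊎ x ≡ F sym

{-# OPTIONS --safe #-}
module Submission where

-- Let F = F(T).  A hole of T of maximal coordinate sum among the holes in h + T is
-- pseudo-Frobenius, hence equal to F, so F − h ∈ T for every hole h: T, and with it
-- S = T ∪ {F}, is F-positioned.
-- Since T + T ⊆ T and F ∉ T, the only decompositions of F into two elements of S are F + 0 and
-- 0 + F.  From this, x ↦ F − x maps I_𝒞(F) ∖ C(S) bijectively onto M(S): for x ∉ C(S) every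
-- element of x + 𝒞 lies in S, so a nonzero s ∈ S below F − x would decompose F as
-- (x + w) + s with x + w ≠ 0 (x ≠ 0, as 0 ∈ C(S) as soon as S has a hole).
-- As C(S) ⊆ I_𝒞(F), this gives |M(S)| + |C(S)| = |I_𝒞(F)|, the sets being counted inside the
-- finite box below F; membership in T, in 𝒞 and in C(S) is decidable because T is finitely
-- generated and 𝒞 ∖ T is finite.  If S has no holes at all, k = 0 works instead.

open import Defs
open import Data.Nat using (ℕ; _≤_)
open import Data.List using (List)

import Data.Integer as ℤ
import Data.Integer.Properties as ℤ
open import Data.Empty using (⊥-elim)
open import Data.List using ([]; _∷_; _++_; map; filter; length; cartesianProductWith; upTo)
open import Data.List.Extrema.Nat using (argmax; argmax-all; f[xs]≤f[argmax])
import Data.List.Membership.DecPropositional as DecMembership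
open import Data.List.Membership.Propositional using (_∈_; find; lose)
open import Data.List.Membership.Propositional.Properties
  using (∈-filter⁺; ∈-filter⁻; ∈-map⁺; ∈-map⁻; ∈-cartesianProductWith⁺; ∈-upTo⁺; ∈-++⁻)
open import Data.List.Properties using (length-map)
open import Data.List.Relation.Unary.All as All using (All; []; _∷_)
import Data.List.Relation.Unary.All.Properties as All
open import Data.List.Relation.Unary.AllPairs using ([]; _∷_)
open import Data.List.Relation.Unary.Any using (Any; here; there; any?)
open import Data.List.Relation.Unary.Unique.Propositional using (Unique)
import Data.List.Relation.Unary.Unique.Propositional.Properties as Unique
open import Data.Nat as ℕ using (suc; _+_; _<_; s≤s)
import Data.Nat.Coprimality as Coprime
import Data.Nat.Induction as ℕ
import Data.Nat.Properties as ℕ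
open import Algebra.Properties.CommutativeSemigroup ℕ.+-commutativeSemigroup using (interchange)
open import Data.Product using (∃-syntax; ∃₂; _×_; _,_; proj₁; proj₂)
open import Data.Rational as ℚ using (ℚ; _/_; mkℚ)
import Data.Rational.Properties as ℚ
open import Data.Sum using (inj₁; inj₂; [_,_])
open import Data.Vec as Vec using ([]; _∷_; zipWith)
open import Data.Vec.Properties as Vec
  using ( zipWith-comm; zipWith-assoc; zipWith-identityˡ; zipWith-identityʳ
        ; ∷-injective; ∷-injectiveˡ; ∷-injectiveʳ; map-replicate)
open import Function using (_∘_)
open import Function.Bundles using (_⇔_; mk⇔; Equivalence)
import Induction.WellFounded as WF
import Relation.Binary.Construct.On as On
open import Relation.Binary.PropositionalEquality
  using (_≡_; _≢_; refl; sym; trans; cong; cong₂; subst; module ≡-Reasoning)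
open import Relation.Nullary using (¬_; Dec; yes; no; contradiction)
open import Relation.Nullary.Decidable using (map′; ¬?; _×-dec_; _⊎-dec_)
open import Relation.Unary using (Decidable; _⊆_; _∩_; ∁)
open import Relation.Unary.Properties using (_∩?_; ∁?)

open Equivalence using (to; from)

infix 4 _≟_
_≟_ : ∀ {d} (x y : Point d) → Dec (x ≡ y)
_≟_ = Vec.≡-dec ℕ._≟_

⊕-comm : ∀ {d} (x y : Point d) → x ⊕ y ≡ y ⊕ x
⊕-comm = zipWith-comm ℕ.+-comm

⊕-assoc : ∀ {d} (x y z : Point d) → (x ⊕ y) ⊕ z ≡ x ⊕ (y ⊕ z)
⊕-assoc = zipWith-assoc ℕ.+-assoc

⊕-identityˡ : ∀ {d} (x : Point d) → 𝟎 ⊕ x ≡ x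
⊕-identityˡ = zipWith-identityˡ ℕ.+-identityˡ

⊕-identityʳ : ∀ {d} (x : Point d) → x ⊕ 𝟎 ≡ x
⊕-identityʳ = zipWith-identityʳ ℕ.+-identityʳ

⊕-cancelˡ : ∀ {d} (x : Point d) {y z} → x ⊕ y ≡ x ⊕ z → y ≡ z
⊕-cancelˡ []      {[]}    {[]}    _ = refl
⊕-cancelˡ (a ∷ x) {b ∷ y} {c ∷ z} e =
  cong₂ _∷_ (ℕ.+-cancelˡ-≡ a b c (∷-injectiveˡ e)) (⊕-cancelˡ x (∷-injectiveʳ e))

⊕-cancelʳ : ∀ {d} (x : Point d) {y z} → y ⊕ x ≡ z ⊕ x → y ≡ z
⊕-cancelʳ x {y} {z} e = ⊕-cancelˡ x (trans (⊕-comm x y) (trans e (⊕-comm z x)))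

⊕-conicalˡ : ∀ {d} (x y : Point d) → x ⊕ y ≡ 𝟎 → x ≡ 𝟎
⊕-conicalˡ []      []      _ = refl
⊕-conicalˡ (a ∷ x) (b ∷ y) e =
  cong₂ _∷_ (ℕ.m+n≡0⇒m≡0 a (∷-injectiveˡ e)) (⊕-conicalˡ x y (∷-injectiveʳ e))

x≡x⊕y⇒y≡𝟎 : ∀ {d} (x y : Point d) → x ≡ x ⊕ y → y ≡ 𝟎
x≡x⊕y⇒y≡𝟎 x y e = sym (⊕-cancelˡ x (trans (⊕-identityʳ x) e))

infixl 6 _⊖_
_⊖_ : ∀ {d} → Point d → Point d → Point d
_⊖_ = zipWith ℕ._∸_

x⊕z⊖x≡z : ∀ {d} (x z : Point d) → x ⊕ z ⊖ x ≡ z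
x⊕z⊖x≡z []      []      = refl
x⊕z⊖x≡z (a ∷ x) (c ∷ z) = cong₂ _∷_ (ℕ.m+n∸m≡n a c) (x⊕z⊖x≡z x z)

y≡x⊕z⇒z≡y⊖x : ∀ {d} {x y z : Point d} → y ≡ x ⊕ z → z ≡ y ⊖ x
y≡x⊕z⇒z≡y⊖x {x = x} {z = z} refl = sym (x⊕z⊖x≡z x z)

size : ∀ {d} → Point d → ℕ
size = Vec.sum

size-⊕ : ∀ {d} (x y : Point d) → size (x ⊕ y) ≡ size x + size y
size-⊕ []      []      = refl
size-⊕ (a ∷ x) (b ∷ y) =
  trans (cong ((a + b) +_) (size-⊕ x y)) (interchange a b (size x) (size y))

size≡0⇒≡𝟎 : ∀ {d} (x : Point d) → size x ≡ 0 → x ≡ 𝟎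
size≡0⇒≡𝟎 []      _ = refl
size≡0⇒≡𝟎 (a ∷ x) e = cong₂ _∷_ (ℕ.m+n≡0⇒m≡0 a e) (size≡0⇒≡𝟎 x (ℕ.m+n≡0⇒n≡0 a e))

size<size-⊕ : ∀ {d} (x y : Point d) → y ≢ 𝟎 → size x < size (x ⊕ y)
size<size-⊕ x y y≢𝟎 rewrite size-⊕ x y =
  ℕ.m<m+n (size x) (ℕ.n≢0⇒n>0 (y≢𝟎 ∘ size≡0⇒≡𝟎 y))

infix 4 _≼⟨_⟩_
_≼⟨_⟩_ : ∀ {d} → Point d → Subset d → Point d → Set
x ≼⟨ P ⟩ y = ∃[ z ] (P z × y ≡ x ⊕ z)

≼-refl : ∀ {d} {P : Subset d} {x} → P 𝟎 → x ≼⟨ P ⟩ x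
≼-refl {x = x} p𝟎 = 𝟎 , p𝟎 , sym (⊕-identityʳ x)

≼-trans : ∀ {d} {P : Subset d} → (∀ {u v} → P u → P v → P (u ⊕ v))
        → ∀ {x y z} → x ≼⟨ P ⟩ y → y ≼⟨ P ⟩ z → x ≼⟨ P ⟩ z
≼-trans P-⊕ {x} (u , pu , refl) (v , pv , refl) = u ⊕ v , P-⊕ pu pv , ⊕-assoc x u v

≼-dec : ∀ {d} {P : Subset d} x y → (∀ z → y ≡ x ⊕ z → Dec (P z)) → Dec (x ≼⟨ P ⟩ y)
≼-dec {P = P} x y P? with y ≟ x ⊕ (y ⊖ x)
... | no y≢x⊕[y⊖x] = no λ (z , _ , y≡x⊕z) →
  y≢x⊕[y⊖x] (subst (λ w → y ≡ x ⊕ w) (y≡x⊕z⇒z≡y⊖x y≡x⊕z) y≡x⊕z)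
... | yes y≡x⊕[y⊖x] = map′ (λ p → y ⊖ x , p , y≡x⊕[y⊖x])
                            (λ (z , pz , y≡x⊕z) → subst P (y≡x⊕z⇒z≡y⊖x y≡x⊕z) pz)
                            (P? (y ⊖ x) y≡x⊕[y⊖x])

m/1+n/1≡[m+n]/1 : ∀ m n → (ℤ.+ m / 1) ℚ.+ (ℤ.+ n / 1) ≡ ℤ.+ (m + n) / 1
m/1+n/1≡[m+n]/1 m n =
  trans (cong₂ ℚ._+_ (n/1≡mkℚ m) (n/1≡mkℚ n))
        (cong (_/ 1) (cong₂ ℤ._+_ (ℤ.*-identityʳ (ℤ.+ m)) (ℤ.*-identityʳ (ℤ.+ n))))
  where
  n/1≡mkℚ : ∀ n → ℤ.+ n / 1 ≡ mkℚ (ℤ.+ n) 0 (Coprime.sym (Coprime.1-coprimeTo n))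
  n/1≡mkℚ n = ℚ.normalize-coprime (Coprime.sym (Coprime.1-coprimeTo n))

toℚ-⊕ : ∀ {d} (x y : Point d) → toℚ (x ⊕ y) ≡ zipWith ℚ._+_ (toℚ x) (toℚ y)
toℚ-⊕ []      []      = refl
toℚ-⊕ (a ∷ x) (b ∷ y) = cong₂ _∷_ (sym (m/1+n/1≡[m+n]/1 a b)) (toℚ-⊕ x y)

combo-++ : ∀ {d} (qas rbs : List (ℚ × Point d))
  → combo (qas ++ rbs) ≡ zipWith ℚ._+_ (combo qas) (combo rbs)
combo-++ []              rbs = sym (zipWith-identityˡ ℚ.+-identityˡ (combo rbs))
combo-++ ((q , a) ∷ qas) rbs =
  trans (cong (zipWith ℚ._+_ _) (combo-++ qas rbs))
        (sym (zipWith-assoc ℚ.+-assoc _ (combo qas) (combo rbs)))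

Cone-𝟎 : ∀ {d} {A : List (Point d)} → Cone A 𝟎
Cone-𝟎 {d} = [] , (λ ()) , map-replicate (λ n → ℤ.+ n / 1) 0 d

Cone-⊕ : ∀ {d} {A : List (Point d)} {x y} → Cone A x → Cone A y → Cone A (x ⊕ y)
Cone-⊕ {x = x} {y} (qas , qas⊆A , x≡qas) (rbs , rbs⊆A , y≡rbs) =
  qas ++ rbs , [ qas⊆A , rbs⊆A ] ∘ ∈-++⁻ qas ,
  trans (toℚ-⊕ x y) (trans (cong₂ (zipWith ℚ._+_) x≡qas y≡rbs) (sym (combo-++ qas rbs)))

Cone-≤ : ∀ {d} {A : List (Point d)} {x y} → Cone A x → x ≤[ A ] y → Cone A y
Cone-≤ cx (z , cz , refl) = Cone-⊕ cx cz

≤-trans : ∀ {d} {A : List (Point d)} {x y z} → x ≤[ A ] y → y ≤[ A ] z → x ≤[ A ] z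
≤-trans = ≼-trans Cone-⊕

≤-dec : ∀ {d} {A : List (Point d)} → Decidable (Cone A) → ∀ x y → Dec (x ≤[ A ] y)
≤-dec Cone? x y = ≼-dec x y λ z _ → Cone? z

I? : ∀ {d} {A : List (Point d)} → Decidable (Cone A) → ∀ k → Decidable (I A k)
I? Cone? k x = Cone? x ×-dec ≤-dec Cone? x k

module _ {d} (G : List (Point d)) where

  private
    NonzeroStep : Point d → Point d → Set
    NonzeroStep x g = g ≢ 𝟎 × g ≼⟨ Generated G ⟩ x

  generated⇒step : ∀ {x} → Generated G x → x ≢ 𝟎 → Any (NonzeroStep x) G
  generated⇒step gen-zero x≢𝟎 = contradiction refl x≢𝟎
  generated⇒step (gen-step {g} {y} g∈G gen-y) g⊕y≢𝟎 with g ≟ 𝟎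
  ... | yes refl = subst (λ x → Any (NonzeroStep x) G) (sym (⊕-identityˡ y))
                         (generated⇒step gen-y (g⊕y≢𝟎 ∘ trans (⊕-identityˡ y)))
  ... | no g≢𝟎 = lose g∈G (g≢𝟎 , y , gen-y , refl)

  step⇒generated : ∀ {x} → Any (NonzeroStep x) G → Generated G x
  step⇒generated any with find any
  ... | g , g∈G , _ , z , gen-z , refl = gen-step g∈G gen-z

  generated? : Decidable (Generated G)
  generated? =
    WF.All.wfRec (On.wellFounded size ℕ.<-wellFounded) _ (λ x → Dec (Generated G x)) decide
    where
    decide : ∀ x → (∀ {z} → size z < size x → Dec (Generated G z)) → Dec (Generated G x)
    decide x smaller? with x ≟ 𝟎
    ... | yes refl = yes gen-zero
    ... | no x≢𝟎 = map′ step⇒generated (λ gen → generated⇒step gen x≢𝟎) (any? step? G)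
      where
      step? : ∀ g → Dec (NonzeroStep x g)
      step? g with g ≟ 𝟎
      ... | yes g≡𝟎 = no λ (g≢𝟎 , _) → g≢𝟎 g≡𝟎
      ... | no g≢𝟎 = map′ (g≢𝟎 ,_) proj₂ (≼-dec g x λ z x≡g⊕z → smaller? (size-z<size-x z x≡g⊕z))
        where
        size-z<size-x : ∀ z → x ≡ g ⊕ z → size z < size x
        size-z<size-x z x≡g⊕z =
          subst (λ w → size z < size w) (trans (⊕-comm z g) (sym x≡g⊕z)) (size<size-⊕ z g g≢𝟎)

below : ∀ {d} → Point d → List (Point d)
below []      = [] ∷ []
below (a ∷ f) = cartesianProductWith _∷_ (upTo (suc a)) (below f)

below-unique : ∀ {d} (f : Point d) → Unique (below f)
below-unique []      = [] ∷ []
below-unique (a ∷ f) =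
  Unique.cartesianProductWith⁺ _∷_ ∷-injective (Unique.upTo⁺ (suc a)) (below-unique f)

∈-below : ∀ {d} (x z : Point d) → x ∈ below (x ⊕ z)
∈-below []      []      = here refl
∈-below (a ∷ x) (c ∷ z) = ∈-cartesianProductWith⁺ _∷_ (∈-upTo⁺ (s≤s (ℕ.m≤m+n a c))) (∈-below x z)

I⊆below : ∀ {d} {A : List (Point d)} {k} → I A k ⊆ (_∈ below k)
I⊆below (_ , z , _ , refl) = ∈-below _ z

module _ {d : ℕ} where

  hasSize-empty : ∀ {P : Subset d} → (∀ x → ¬ P x) → HasSize P 0
  hasSize-empty ¬P = [] , [] , (λ x → mk⇔ (⊥-elim ∘ ¬P x) λ ()) , refl

  hasSize-singleton : ∀ {P : Subset d} {a} → (∀ x → P x ⇔ x ≡ a) → HasSize P 1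
  hasSize-singleton {a = a} P⇔≡a =
    a ∷ [] , [] ∷ [] ,
    (λ x → mk⇔ (here ∘ to (P⇔≡a x)) λ { (here x≡a) → from (P⇔≡a x) x≡a ; (there ()) }) , refl

  hasSize-filter : ∀ {P : Subset d} {B} → Unique B → (∀ {x} → P x → x ∈ B)
    → (P? : Decidable P) → HasSize P (length (filter P? B))
  hasSize-filter {B = B} B-unique P⊆B P? =
    filter P? B , Unique.filter⁺ P? B-unique ,
    (λ x → mk⇔ (λ px → ∈-filter⁺ P? (P⊆B px) px) (proj₂ ∘ ∈-filter⁻ P? {xs = B})) , refl

  hasSize-image : ∀ {P Q : Subset d} {n} (σ : Point d → Point d)
    → (∀ {x x′} → P x → P x′ → σ x ≡ σ x′ → x ≡ x′)
    → (∀ y → Q y ⇔ (∃[ x ] (P x × y ≡ σ x)))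
    → HasSize P n → HasSize Q n
  hasSize-image {P} {Q} σ σ-injective Q⇔image (L , L-unique , P⇔∈L , refl) =
    map σ L , map-unique (All.tabulate (from (P⇔∈L _))) L-unique ,
    (λ y → mk⇔ (image⇒∈ y ∘ to (Q⇔image y)) (∈⇒image y)) , length-map σ L
    where
    map-unique : ∀ {xs} → All P xs → Unique xs → Unique (map σ xs)
    map-unique []         []                 = []
    map-unique (px ∷ pxs) (x∉xs ∷ xs-unique) =
      All.map⁺ (All.zipWith (λ (px′ , x≢x′) → x≢x′ ∘ σ-injective px px′) (pxs , x∉xs))
      ∷ map-unique pxs xs-unique
    image⇒∈ : ∀ y → ∃[ x ] (P x × y ≡ σ x) → y ∈ map σ L
    image⇒∈ y (x , px , refl) = ∈-map⁺ σ (to (P⇔∈L x) px)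
    ∈⇒image : ∀ y → y ∈ map σ L → Q y
    ∈⇒image y y∈ with ∈-map⁻ σ y∈
    ... | x , x∈L , y≡σx = from (Q⇔image y) (x , from (P⇔∈L x) x∈L , y≡σx)

  module _ {P Q : Subset d} (P? : Decidable P) (Q? : Decidable Q) (Q⊆P : Q ⊆ P) where

    length-filter-partition : ∀ xs
      → length (filter P? xs) ≡ length (filter (P? ∩? ∁? Q?) xs) + length (filter Q? xs)
    length-filter-partition []       = refl
    length-filter-partition (x ∷ xs) with P? x | Q? x
    ... | yes _ | yes _ = trans (cong suc (length-filter-partition xs)) (sym (ℕ.+-suc _ _))
    ... | yes _ | no  _ = cong suc (length-filter-partition xs)
    ... | no ¬p | yes q = contradiction (Q⊆P q) ¬p
    ... | no  _ | no  _ = length-filter-partition xs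

    hasSize-partition : ∀ {B} → Unique B → (∀ {x} → P x → x ∈ B)
      → ∃₂ λ a b → HasSize Q a × HasSize (P ∩ ∁ Q) b × HasSize P (b + a)
    hasSize-partition {B = B} B-unique P⊆B =
      _ , _ ,
      hasSize-filter B-unique (λ q → P⊆B (Q⊆P q)) Q? ,
      hasSize-filter B-unique (λ (p , _) → P⊆B p) (P? ∩? ∁? Q?) ,
      subst (HasSize P) (length-filter-partition B) (hasSize-filter B-unique P⊆B P?)

Isolated : ∀ {d} → List (Point d) → Subset d → Point d → Set
Isolated A S y = ∀ s → S s → s ≤[ A ] y → s ≡ 𝟎

module _ {d} {A : List (Point d)} {S : Subset d} where

  M⇒Cone : ∀ {y} → M A S y → Cone A y
  M⇒Cone (inj₁ ((cy , _) , _)) = cy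
  M⇒Cone (inj₂ refl)           = Cone-𝟎

  M⇒Isolated : ∀ {y} → M A S y → Isolated A S y
  M⇒Isolated (inj₁ (_ , isolated)) = isolated
  M⇒Isolated (inj₂ refl) s _ (z , _ , 𝟎≡s⊕z) = ⊕-conicalˡ s z (sym 𝟎≡s⊕z)

  Isolated⇒M : ∀ {y} → Cone A y → Isolated A S y → M A S y
  Isolated⇒M {y} cy isolated with y ≟ 𝟎
  ... | yes y≡𝟎 = inj₂ y≡𝟎
  ... | no y≢𝟎  = inj₁ ((cy , λ sy → y≢𝟎 (isolated y sy (≼-refl Cone-𝟎))) , isolated)

  𝟎∈CS : ∀ {h} → Hole A S h → CS A S 𝟎
  𝟎∈CS {h} hole = Cone-𝟎 , h , hole , h , proj₁ hole , sym (⊕-identityˡ h)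

  CS? : Decidable (Cone A) → Finite (Hole A S) → Decidable (CS A S)
  CS? Cone? (holes , hole⇔∈) x =
    map′ (λ (cx , any) → cx , below-hole (find any))
         (λ (cx , h , hole , x≤h) → cx , lose (to (hole⇔∈ h) hole) x≤h)
         (Cone? x ×-dec any? (≤-dec Cone? x) holes)
    where
    below-hole : ∃[ h ] (h ∈ holes × x ≤[ A ] h) → ∃[ h ] (Hole A S h × x ≤[ A ] h)
    below-hole (h , h∈ , x≤h) = h , from (hole⇔∈ h) h∈ , x≤h

  ¬CS⇒upward-closed : Decidable S → ∀ {x z} → Cone A x → ¬ CS A S x → x ≤[ A ] z → S z
  ¬CS⇒upward-closed S? {z = z} cx ¬CS-x x≤z with S? z
  ... | yes sz = sz
  ... | no ¬sz = contradiction (cx , z , (Cone-≤ cx x≤z , ¬sz) , x≤z) ¬CS-x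

  noHoles⇒primaryPositioned : (∀ h → ¬ Hole A S h) → PrimaryPositioned A S
  noHoles⇒primaryPositioned noHoles =
    𝟎 , Cone-𝟎 , (λ h hole → contradiction hole (noHoles h)) , 1 , 0 , 1 ,
    hasSize-singleton (λ y → mk⇔ M⇒≡𝟎 inj₂) ,
    hasSize-empty (λ x (_ , h , hole , _) → noHoles h hole) ,
    hasSize-singleton (λ x → mk⇔ (λ (_ , z , _ , 𝟎≡x⊕z) → ⊕-conicalˡ x z (sym 𝟎≡x⊕z))
                                 (λ { refl → Cone-𝟎 , ≼-refl Cone-𝟎 })) ,
    refl
    where
    M⇒≡𝟎 : ∀ {y} → M A S y → y ≡ 𝟎
    M⇒≡𝟎 (inj₁ (hole , _)) = contradiction hole (noHoles _)
    M⇒≡𝟎 (inj₂ y≡𝟎)        = y≡𝟎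

  module Positioned {k} (S⊆Cone : S ⊆ Cone A) (positioned : KPositioned A S k) where

    hole≤k : ∀ {h} → Hole A S h → h ≤[ A ] k
    hole≤k hole with positioned _ hole
    ... | s , ss , k≡h⊕s = s , S⊆Cone ss , k≡h⊕s

    CS⊆I : CS A S ⊆ I A k
    CS⊆I (cx , h , hole , x≤h) = cx , ≤-trans x≤h (hole≤k hole)

    M⇒≤k : Cone A k → ∀ {y} → M A S y → y ≤[ A ] k
    M⇒≤k _  (inj₁ (hole , _)) = hole≤k hole
    M⇒≤k ck (inj₂ refl)       = k , ck , sym (⊕-identityˡ k)

    Isolated⇒¬CS : S k → ∀ {x y} → k ≡ x ⊕ y → Isolated A S y → ¬ CS A S x
    Isolated⇒¬CS sk {x} {y} k≡x⊕y isolated (_ , h , hole@(_ , ¬sh) , z , cz , refl)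
      with positioned h hole
    ... | s , ss , k≡h⊕s = ¬sh (subst S k≡h sk)
      where
      open ≡-Reasoning
      y≡s⊕z : y ≡ s ⊕ z
      y≡s⊕z = ⊕-cancelˡ x (begin
        x ⊕ y       ≡⟨ sym k≡x⊕y ⟩
        k           ≡⟨ k≡h⊕s ⟩
        x ⊕ z ⊕ s   ≡⟨ ⊕-assoc x z s ⟩
        x ⊕ (z ⊕ s) ≡⟨ cong (x ⊕_) (⊕-comm z s) ⟩
        x ⊕ (s ⊕ z) ∎)
      k≡h : k ≡ x ⊕ z
      k≡h = begin
        k           ≡⟨ k≡h⊕s ⟩
        x ⊕ z ⊕ s   ≡⟨ cong (x ⊕ z ⊕_) (isolated s ss (z , cz , y≡s⊕z)) ⟩
        x ⊕ z ⊕ 𝟎   ≡⟨ ⊕-identityʳ (x ⊕ z) ⟩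
        x ⊕ z       ∎

module CSemigroup {d} {A : List (Point d)} {T : Subset d} (isC : IsCSemigroup A T) where

  open IsCSemigroup isC
  open DecMembership (_≟_ {d}) using (_∈?_)

  holes : List (Point d)
  holes = proj₁ finHoles

  hole⇔∈holes : ∀ x → Hole A T x ⇔ x ∈ holes
  hole⇔∈holes = proj₂ finHoles

  T? : Decidable T
  T? x = map′ (from (proj₂ finGen x)) (to (proj₂ finGen x)) (generated? (proj₁ finGen) x)

  _≼⟨T⟩?_ : ∀ x y → Dec (x ≼⟨ T ⟩ y)
  x ≼⟨T⟩? y = ≼-dec x y λ z _ → T? z

  Cone? : Decidable (Cone A)
  Cone? x with T? x | x ∈? holes
  ... | yes tx | _      = yes (inCone tx)
  ... | no  _  | yes h  = yes (proj₁ (from (hole⇔∈holes x) h))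
  ... | no ¬tx | no  ¬h = no λ cx → ¬h (to (hole⇔∈holes x) (cx , ¬tx))

  hole≼pseudoFrobenius : ∀ {h} → Hole A T h → ∃[ m ] (IsPF A T m × h ≼⟨ T ⟩ m)
  hole≼pseudoFrobenius {h} hole-h = m , (hole-m , m+T⁺⊆T) , h≼m
    where
    T-⊕ : ∀ {x y} → T x → T y → T (x ⊕ y)
    T-⊕ = proj₂ submonoid
    above : List (Point d)
    above = filter (h ≼⟨T⟩?_) holes
    m : Point d
    m = argmax size h above
    hole-m×h≼m : Hole A T m × h ≼⟨ T ⟩ m
    hole-m×h≼m = argmax-all size (hole-h , ≼-refl (proj₁ submonoid))
      (All.tabulate λ x∈ → let (x∈holes , h≼x) = ∈-filter⁻ (h ≼⟨T⟩?_) x∈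
                           in from (hole⇔∈holes _) x∈holes , h≼x)
    hole-m = proj₁ hole-m×h≼m
    h≼m = proj₂ hole-m×h≼m
    m+T⁺⊆T : ∀ s → T s → s ≢ 𝟎 → T (m ⊕ s)
    m+T⁺⊆T s ts s≢𝟎 with T? (m ⊕ s)
    ... | yes t = t
    ... | no ¬t = contradiction (All.lookup (f[xs]≤f[argmax] {f = size} h above) m⊕s∈above)
                                (ℕ.<⇒≱ (size<size-⊕ m s s≢𝟎))
      where
      m⊕s∈above : m ⊕ s ∈ above
      m⊕s∈above = ∈-filter⁺ (h ≼⟨T⟩?_)
        (to (hole⇔∈holes _) (Cone-⊕ (proj₁ hole-m) (inCone ts) , ¬t))
        (≼-trans T-⊕ h≼m (s , ts , refl))

  F-positioned : (symmetric : Symmetric A T) → KPositioned A T (F symmetric)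
  F-positioned (_ , f , _ , PF⇔≡f) h hole with hole≼pseudoFrobenius hole
  ... | m , pf , h≼m = subst (h ≼⟨ T ⟩_) (to (PF⇔≡f m) pf) h≼m

module UESYSemigroup {d} {A : List (Point d)} {T : Subset d}
                     (isC : IsCSemigroup A T) (symmetric : Symmetric A T) where

  open IsCSemigroup isC
  open CSemigroup isC

  f : Point d
  f = F symmetric

  S : Subset d
  S = UESY symmetric

  hole-f : Hole A T f
  hole-f = proj₁ (proj₁ (proj₂ (proj₂ symmetric)))

  S? : Decidable S
  S? x = T? x ⊎-dec x ≟ f

  S⊆Cone : S ⊆ Cone A
  S⊆Cone = [ inCone , (λ { refl → proj₁ hole-f }) ]

  S-positioned : KPositioned A S f
  S-positioned h (ch , ¬sh) with F-positioned symmetric h (ch , ¬sh ∘ inj₁)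
  ... | t , tt , f≡h⊕t = t , inj₁ tt , f≡h⊕t

  finiteHoles : Finite (Hole A S)
  finiteHoles = filter ≢f? holes , λ h → mk⇔
    (λ (ch , ¬sh) → ∈-filter⁺ ≢f? (to (hole⇔∈holes h) (ch , ¬sh ∘ inj₁)) (¬sh ∘ inj₂))
    (λ h∈ → let (h∈holes , h≢f) = ∈-filter⁻ ≢f? {xs = holes} h∈
                (ch , ¬th) = from (hole⇔∈holes h) h∈holes
            in ch , [ ¬th , h≢f ])
    where
    ≢f? : Decidable (_≢ f)
    ≢f? h = ¬? (h ≟ f)

  f-decomposition : ∀ {a b} → S a → S b → b ≢ 𝟎 → f ≡ a ⊕ b → a ≡ 𝟎
  f-decomposition {a}     _           (inj₂ refl) _   f≡a⊕f =
    x≡x⊕y⇒y≡𝟎 f a (trans f≡a⊕f (⊕-comm a f))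
  f-decomposition         (inj₁ ta)   (inj₁ tb)   _   f≡a⊕b =
    contradiction (subst T (sym f≡a⊕b) (proj₂ submonoid ta tb)) (proj₂ hole-f)
  f-decomposition {b = b} (inj₂ refl) (inj₁ _)    b≢𝟎 f≡f⊕b =
    contradiction (x≡x⊕y⇒y≡𝟎 f b f≡f⊕b) b≢𝟎

  open Positioned S⊆Cone S-positioned

  I∖CS : Subset d
  I∖CS = I A f ∩ ∁ (CS A S)

  module _ (CS-𝟎 : CS A S 𝟎) where

    I∖CS⇒Isolated : ∀ {x y} → I∖CS x → f ≡ x ⊕ y → Isolated A S y
    I∖CS⇒Isolated {x} {y} ((cx , _) , ¬CS-x) f≡x⊕y s ss (w , cw , y≡s⊕w) with s ≟ 𝟎
    ... | yes s≡𝟎 = s≡𝟎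
    ... | no s≢𝟎 = contradiction (subst (CS A S) (sym x≡𝟎) CS-𝟎) ¬CS-x
      where
      open ≡-Reasoning
      x⊕w≡𝟎 : x ⊕ w ≡ 𝟎
      x⊕w≡𝟎 = f-decomposition (¬CS⇒upward-closed S? cx ¬CS-x (w , cw , refl)) ss s≢𝟎 (begin
        f           ≡⟨ f≡x⊕y ⟩
        x ⊕ y       ≡⟨ cong (x ⊕_) (trans y≡s⊕w (⊕-comm s w)) ⟩
        x ⊕ (w ⊕ s) ≡⟨ ⊕-assoc x w s ⟨
        x ⊕ w ⊕ s   ∎)
      x≡𝟎 : x ≡ 𝟎
      x≡𝟎 = ⊕-conicalˡ x w x⊕w≡𝟎

    M⇔f⊖I∖CS : ∀ y → M A S y ⇔ (∃[ x ] (I∖CS x × y ≡ f ⊖ x))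
    M⇔f⊖I∖CS y = mk⇔ M⇒ ⇒M
      where
      M⇒ : M A S y → ∃[ x ] (I∖CS x × y ≡ f ⊖ x)
      M⇒ my with M⇒≤k (proj₁ hole-f) my
      ... | x , cx , f≡y⊕x =
        x , ((cx , y , M⇒Cone my , f≡x⊕y) , Isolated⇒¬CS (inj₂ refl) f≡x⊕y (M⇒Isolated my)) ,
        y≡x⊕z⇒z≡y⊖x f≡x⊕y
        where
        f≡x⊕y : f ≡ x ⊕ y
        f≡x⊕y = trans f≡y⊕x (⊕-comm y x)
      ⇒M : ∃[ x ] (I∖CS x × y ≡ f ⊖ x) → M A S y
      ⇒M (x , x∈I∖CS@((_ , z , cz , f≡x⊕z) , _) , refl) =
        subst (M A S) (y≡x⊕z⇒z≡y⊖x f≡x⊕z) (Isolated⇒M cz (I∖CS⇒Isolated x∈I∖CS f≡x⊕z))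

    f⊖-injective : ∀ {x x′} → I∖CS x → I∖CS x′ → f ⊖ x ≡ f ⊖ x′ → x ≡ x′
    f⊖-injective ((_ , z , _ , f≡x⊕z) , _) ((_ , z′ , _ , f≡x′⊕z′) , _) f⊖x≡f⊖x′ =
      ⊕-cancelʳ z (trans (sym f≡x⊕z) (trans f≡x′⊕z′ (cong (_ ⊕_) z′≡z)))
      where
      z′≡z : z′ ≡ z
      z′≡z = trans (y≡x⊕z⇒z≡y⊖x f≡x′⊕z′) (trans (sym f⊖x≡f⊖x′) (sym (y≡x⊕z⇒z≡y⊖x f≡x⊕z)))

    primaryPositioned-at-f : PrimaryPositioned A S
    primaryPositioned-at-f
      with hasSize-partition (I? Cone? f) (CS? Cone? finiteHoles) CS⊆I (below-unique f) I⊆below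
    ... | c , j , size-CS , size-I∖CS , size-I =
      f , proj₁ hole-f , S-positioned , j , c , j + c ,
      hasSize-image (f ⊖_) f⊖-injective M⇔f⊖I∖CS size-I∖CS , size-CS , size-I , refl

  primaryPositioned : PrimaryPositioned A S
  primaryPositioned with CS? Cone? finiteHoles 𝟎
  ... | yes CS-𝟎 = primaryPositioned-at-f CS-𝟎
  ... | no ¬CS-𝟎 = noHoles⇒primaryPositioned (λ h hole → ¬CS-𝟎 (𝟎∈CS hole))

theorem3p2 : (d : ℕ) → 1 ≤ d → (A : List (Point d)) (T : Subset d)
    → IsCSemigroup A T
    → (sym : Symmetric A T)
    → PrimaryPositioned A (UESY sym)
-- The argument does not use d ≥ 1.
theorem3p2 _ _ _ _ isC symmetric = UESYSemigroup.primaryPositioned isC symmetric
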